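{- Let $t$ be a positive integer. If $\mathcal A\in I(n,t)$ is maximal and fixed, then $G(\mathcal A)\neq\emptyset$.
   Context: $S_n$ is the symmetric group on $[n]=\{1,\dots,n\}$; $\mathrm{fix}(\sigma)=\{x:\sigma(x)=x\}$. Two permutations have a cycle in common if that cycle appears in both cycle decompositions (1-cycles count). A family $\mathcal A\subseteq S_n$ is $t$-cycle-intersecting if any two distinct members have at least $t$ cycles in common; $I(n,t)$ is the collection of all such families. $\mathcal A\in I(n,t)$ is maximal if for every $\sigma\in S_n\setminus\mathcal A$, $\mathcal A\cup\{\sigma\}$ is not $t$-cycle-intersecting. For $i\neq j$ and $\sigma\in S_n$, the $ij$-fixing ${}_{[ij]}\sigma$ is: $\sigma$ if $\sigma(i)\neq j$; if $\sigma(i)=j$, then ${}_{[ij]}\sigma(i)=i$, ${}_{[ij]}\sigma(\sigma^{ -1}(i))=j$, and ${}_{[ij]}\sigma(x)=\sigma(x)$ otherwise. $\triangleleft_{ij}(\mathcal A)=\{\triangleleft_{ij}(\sigma):\sigma\in\mathcal A\}$ where $\triangleleft_{ij}(\sigma)={}_{[ij]}\sigma$ if ${}_{[ij]}\sigma\notin\mathcal A$ and $\sigma$ otherwise; $\mathcal A$ is fixed if $\triangleleft_{ij}(\mathcal A)=\mathcal A$ for all $i\neq j$. For $B\subseteq[n]$, $\mathscr U_p(B)=\{\sigma\in S_n: B\subseteq\mathrm{fix}(\sigma)\}$, and $\mathscr U_p(\mathcal B)=\bigcup_{B\in\mathcal B}\mathscr U_p(B)$. A collection $g$ of subsets of $[n]$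 is a generating set for $\mathcal A$ if $g$ contains no set of cardinality $n-1$ and $\mathscr U_p(g)=\mathcal A$; $G(\mathcal A)$ is the set of all generating sets of $\mathcal A$. -}

module Defs where

open import Data.Nat as ℕ using (ℕ; zero; suc; _+_)
open import Data.Bool using (Bool; true; false; _∨_; if_then_else_)
open import Data.Fin as Fin using (Fin)
open import Data.Fin.Subset using (Subset; _∈_; _⊆_; ∣_∣)
open import Data.Vec using (Vec; lookup; tabulate)
import Data.Vec.Properties as VecP
open import Data.List using (List; []; _∷_; map; filter; takeWhile; upTo; allFin; length)
import Data.List.Properties as ListP
open import Data.List.Relation.Unary.All using (all?)
import Data.List.Membership.DecPropositional as DecMem
open import Data.Product using (Σ; _×_; _,_)
open import Relation.Nullary using (¬_; ¬?; does)
open import Relation.Binary.PropositionalEquality using (_≡_; _≢_)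

-- Raw permutation candidates: σ is given by its table (σ(0),…,σ(n-1)).
Raw : ℕ → Set
Raw n = Vec (Fin n) n

app : ∀ {n} → Raw n → Fin n → Fin n
app σ x = lookup σ x

-- σ ∈ S_n : the table is injective (hence bijective on Fin n).
IsPerm : ∀ {n} → Raw n → Set
IsPerm {n} σ = ∀ (i j : Fin n) → app σ i ≡ app σ j → i ≡ j

iter : ∀ {n} → Raw n → ℕ → Fin n → Fin n
iter σ zero    x = x
iter σ (suc k) x = app σ (iter σ k x)

orbit : ∀ {n} → Raw n → Fin n → List (Fin n)
orbit {n} σ x = x ∷ takeWhile (λ y → ¬? (y Fin.≟ x)) (map (λ k → iter σ (suc k) x) (upTo n))

-- The cycles of the cycle decomposition of σ (1-cycles included), each written
-- canonically starting from its least element.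
cycles : ∀ {n} → Raw n → List (List (Fin n))
cycles {n} σ = map (orbit σ) (filter (λ x → all? (λ y → x Fin.≤? y) (orbit σ x)) (allFin n))

commonCycles : ∀ {n} → Raw n → Raw n → ℕ
commonCycles {n} σ τ = length (filter (λ c → c ∈? cycles τ) (cycles σ))
  where open DecMem (ListP.≡-dec (Fin._≟_ {n}))

-- Families of permutations, as decidable (Bool-valued) subsets of raw tables.
Family : ℕ → Set
Family n = Raw n → Bool

_∈F_ : ∀ {n} → Raw n → Family n → Set
σ ∈F A = A σ ≡ true

SubsetOfSn : ∀ {n} → Family n → Set
SubsetOfSn A = ∀ σ → σ ∈F A → IsPerm σ

SameFamily : ∀ {n} → Family n → Family n → Set
SameFamily A B = ∀ σ → (σ ∈F A → σ ∈F B) × (σ ∈F B → σ ∈F A)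

_≟R_ : ∀ {n} (σ τ : Raw n) → _
_≟R_ {n} = VecP.≡-dec (Fin._≟_ {n})

insertF : ∀ {n} → Raw n → Family n → Family n
insertF σ A τ = A τ ∨ does (τ ≟R σ)

CycleIntersecting : ∀ {n} → ℕ → Family n → Set
CycleIntersecting t A = ∀ σ τ → σ ∈F A → τ ∈F A → σ ≢ τ → t ℕ.≤ commonCycles σ τ

InI : (n t : ℕ) → Family n → Set
InI n t A = SubsetOfSn A × CycleIntersecting t A

Maximal : (n t : ℕ) → Family n → Set
Maximal n t A = InI n t A ×
  (∀ σ → IsPerm σ → ¬ (σ ∈F A) → ¬ CycleIntersecting t (insertF σ A))

ijFix : ∀ {n} → Fin n → Fin n → Raw n → Raw n
ijFix i j σ =
  if does (app σ i Fin.≟ j)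
  then tabulate (λ x → if does (x Fin.≟ i) then i
                       else if does (app σ x Fin.≟ i) then j
                       else app σ x)
  else σ

triangle : ∀ {n} → Family n → Fin n → Fin n → Raw n → Raw n
triangle A i j σ = if A (ijFix i j σ) then σ else ijFix i j σ

triangleF : ∀ {n} → Family n → Fin n → Fin n → Raw n → Set
triangleF A i j τ = Σ _ (λ σ → σ ∈F A × triangle A i j σ ≡ τ)

Fixed : ∀ {n} → Family n → Set
Fixed {n} A = ∀ (i j : Fin n) → i ≢ j →
  ∀ τ → (triangleF A i j τ → τ ∈F A) × (τ ∈F A → triangleF A i j τ)

SetFamily : ℕ → Set
SetFamily n = Subset n → Bool

FixesAll : ∀ {n} → Subset n → Raw n → Set
FixesAll B σ = ∀ x → x ∈ B → app σ x ≡ x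

InUp : ∀ {n} → SetFamily n → Raw n → Set
InUp g σ = Σ _ (λ B → g B ≡ true × FixesAll B σ)

IsGeneratingSet : ∀ {n} → Family n → SetFamily n → Set
IsGeneratingSet {n} A g =
  (∀ B → g B ≡ true → ∣ B ∣ + 1 ≢ n) ×
  (∀ σ → IsPerm σ → (σ ∈F A → InUp g σ) × (InUp g σ → σ ∈F A))

module Submission where

-- (1) Upward closure.  In a fixed t-cycle-intersecting family any two distinct
--     members share at least t fixed points: while ρ and τ share a cycle of
--     length ≥ 2 through i, replace ρ by its ij-fixing along the arc i ↦ ρ i.
--     This stays in A (A is fixed), stays distinct from τ, fixes strictly more
--     points and gains no common fixed point with τ; once no long cycle is
--     shared, the common cycles of ρ and τ are exactly their common fixed points.
--     Consequently, if τ ∈ A and fix(τ) ⊆ fix(σ), then A ∪ {σ} is still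
--     t-cycle-intersecting, so σ ∈ A by maximality.
--
-- (2) Generating sets.  Any upward closed A ⊆ S_n (in the sense of (1)) is
--     generated by the sets B containing fix(τ) for some τ ∈ A with |B| ≠ n - 1,
--     because no permutation fixes exactly n - 1 points.

open import Defs
open import Data.Nat as ℕ using (ℕ; zero; suc; _+_; _≤_; _<_; s≤s)
import Data.Nat.Properties as ℕP
open import Data.Bool as Bool using (true; false; if_then_else_)
open import Data.Fin as Fin using (Fin)
import Data.Fin.Properties as FinP
open import Data.Fin.Subset using (Subset; ⁅_⁆; _∪_; ⊤; ∁; ∣_∣; _⊂_)
  renaming (_∈_ to _∈ₛ_; _⊆_ to _⊆ₛ_)
import Data.Fin.Subset.Properties as SP
open import Data.Vec using (Vec; []; _∷_; tabulate; lookup)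
import Data.Vec.Properties as VecP
open import Data.List using (List; []; _∷_; map; filter; length; allFin)
import Data.List.Properties as ListP
open import Data.List.Membership.Propositional using () renaming (_∈_ to _∈ₗ_)
import Data.List.Membership.Propositional.Properties as MemP
import Data.List.Membership.DecPropositional as DecMem
open import Data.List.Relation.Unary.All using (All; []; _∷_; all?)
open import Data.List.Relation.Binary.Sublist.Propositional using ()
  renaming (_⊆_ to _⊑_; ⊆-refl to ⊑-refl)
import Data.List.Relation.Binary.Sublist.Propositional.Properties as Sublist
open import Data.Product using (Σ; ∃; _×_; _,_; proj₁; proj₂)
open import Data.Sum using (_⊎_; inj₁; inj₂)
open import Data.Empty using (⊥; ⊥-elim)
open import Function using (_∘_)
open import Level using (0ℓ)
open import Relation.Nullary using (¬_; Dec; yes; no; does; ¬?)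
open import Relation.Nullary.Decidable
  using (_×-dec_; map′; dec-true; decidable-stable)
open import Relation.Unary using (Pred; Decidable)
open import Relation.Binary.PropositionalEquality

private
  variable
    n : ℕ
    x : Fin n
    σ τ : Raw n

does-true⁻ : ∀ {P : Set} (P? : Dec P) → does P? ≡ true → P
does-true⁻ (yes p) _  = p
does-true⁻ (no _)  ()

count-mono : ∀ {A : Set} {P Q : Pred A 0ℓ} (P? : Decidable P) (Q? : Decidable Q)
  {xs ys : List A} → (∀ {a} → P a → Q a) → xs ⊑ ys →
  length (filter P? xs) ≤ length (filter Q? ys)
count-mono P? Q? P⇒Q xs⊑ys =
  Sublist.length-mono-≤ (Sublist.filter⁺ P? Q? (λ { refl → P⇒Q }) xs⊑ys)

filter-map : ∀ {A B : Set} {P : Pred B 0ℓ} (P? : Decidable P) (f : A → B) (xs : List A) →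
  filter P? (map f xs) ≡ map f (filter (P? ∘ f) xs)
filter-map P? f [] = refl
filter-map P? f (a ∷ xs) with does (P? (f a))
... | true  = cong (f a ∷_) (filter-map P? f xs)
... | false = filter-map P? f xs

anyVec? : ∀ m {P : Pred (Vec (Fin n) m) 0ℓ} → Decidable P → Dec (∃ P)
anyVec? zero    P? = map′ ([] ,_) (λ { ([] , p) → p }) (P? [])
anyVec? (suc m) P? =
  map′ (λ { (a , v , p) → a ∷ v , p }) (λ { (a ∷ v , p) → a , v , p })
       (FinP.any? λ a → anyVec? m (λ v → P? (a ∷ v)))

Fixes : Raw n → Fin n → Set
Fixes σ x = app σ x ≡ x

fixes? : (σ : Raw n) → Decidable (Fixes σ)
fixes? σ x = app σ x Fin.≟ x

Fix : Raw n → Subset n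
Fix σ = tabulate (does ∘ fixes? σ)

∈Fix⁺ : (σ : Raw n) → Fixes σ x → x ∈ₛ Fix σ
∈Fix⁺ {x = x} σ σx≡x =
  VecP.lookup⇒[]= x (Fix σ) (trans (VecP.lookup∘tabulate _ x) (dec-true (fixes? σ x) σx≡x))

∈Fix⁻ : (σ : Raw n) → x ∈ₛ Fix σ → Fixes σ x
∈Fix⁻ {x = x} σ x∈fix =
  does-true⁻ (fixes? σ x) (trans (sym (VecP.lookup∘tabulate _ x)) (VecP.[]=⇒lookup x∈fix))

table-ext : (∀ x → app σ x ≡ app τ x) → σ ≡ τ
table-ext {σ = σ} {τ} σ≗τ = begin
  σ                   ≡⟨ sym (VecP.tabulate∘lookup σ) ⟩
  tabulate (lookup σ) ≡⟨ VecP.tabulate-cong σ≗τ ⟩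
  tabulate (lookup τ) ≡⟨ VecP.tabulate∘lookup τ ⟩
  τ                   ∎
  where open ≡-Reasoning

identity-or-moves : (σ : Raw n) → (∀ x → Fixes σ x) ⊎ ∃ (λ x → ¬ Fixes σ x)
identity-or-moves σ with FinP.any? (λ x → ¬? (fixes? σ x))
... | yes moved = inj₂ moved
... | no  none  = inj₁ λ x → decidable-stable (fixes? σ x) (λ ¬σx≡x → none (x , ¬σx≡x))

distinct⇒moves : (∀ {x} → Fixes τ x → Fixes σ x) → τ ≢ σ → ∃ (λ x → ¬ Fixes τ x)
distinct⇒moves {τ = τ} fixτ⊆fixσ τ≢σ with identity-or-moves τ
... | inj₂ moved = moved
... | inj₁ id    = ⊥-elim (τ≢σ (table-ext λ x → trans (id x) (sym (fixτ⊆fixσ (id x)))))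

-- A permutation moving x also moves σ x ≠ x, so it fixes at most n - 2 points.
moved-pair : (σ : Raw n) → IsPerm σ → ¬ Fixes σ x → 2 + ∣ Fix σ ∣ ≤ n
moved-pair {n} {x} σ σ-inj σx≢x =
  begin
    2 + ∣ Fix σ ∣                       ≤⟨ s≤s (SP.p⊂q⇒∣p∣<∣q∣ fix⊂fix+x) ⟩
    1 + ∣ Fix σ ∪ ⁅ x ⁆ ∣                ≤⟨ SP.p⊂q⇒∣p∣<∣q∣ fix+x⊂fix+x+σx ⟩
    ∣ (Fix σ ∪ ⁅ x ⁆) ∪ ⁅ app σ x ⁆ ∣   ≤⟨ SP.∣p∣≤n ((Fix σ ∪ ⁅ x ⁆) ∪ ⁅ app σ x ⁆) ⟩
    n                                   ∎
  where
  open ℕP.≤-Reasoning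

  σσx≢σx : ¬ Fixes σ (app σ x)
  σσx≢σx σσx≡σx = σx≢x (σ-inj (app σ x) x σσx≡σx)

  fix⊂fix+x : Fix σ ⊂ Fix σ ∪ ⁅ x ⁆
  fix⊂fix+x = SP.p⊆p∪q ⁅ x ⁆ , x , SP.x∈p∪q⁺ (inj₂ (SP.x∈⁅x⁆ x)) , σx≢x ∘ ∈Fix⁻ σ

  fix+x⊂fix+x+σx : Fix σ ∪ ⁅ x ⁆ ⊂ (Fix σ ∪ ⁅ x ⁆) ∪ ⁅ app σ x ⁆
  fix+x⊂fix+x+σx =
    SP.p⊆p∪q ⁅ app σ x ⁆ , app σ x , SP.x∈p∪q⁺ (inj₂ (SP.x∈⁅x⁆ (app σ x))) ,
    λ σx∈ → case-∪ (SP.x∈p∪q⁻ (Fix σ) ⁅ x ⁆ σx∈)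
    where
    case-∪ : app σ x ∈ₛ Fix σ ⊎ app σ x ∈ₛ ⁅ x ⁆ → ⊥
    case-∪ (inj₁ σx∈fix) = σσx≢σx (∈Fix⁻ σ σx∈fix)
    case-∪ (inj₂ σx∈⁅x⁆) = σx≢x (SP.x∈⁅y⁆⇒x≡y x σx∈⁅x⁆)

fix-size-gap : (σ : Raw n) → IsPerm σ → n ≤ ∣ Fix σ ∣ ⊎ 2 + ∣ Fix σ ∣ ≤ n
fix-size-gap {n} σ σ-inj with identity-or-moves σ
... | inj₂ (x , σx≢x) = inj₂ (moved-pair σ σ-inj σx≢x)
... | inj₁ id = inj₁ (subst (_≤ ∣ Fix σ ∣) (SP.∣⊤∣≡n n)
                        (SP.p⊆q⇒∣p∣≤∣q∣ {p = ⊤} (λ {y} _ → ∈Fix⁺ σ (id y))))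

fix-size≢n-1 : (σ : Raw n) → IsPerm σ → ∣ Fix σ ∣ + 1 ≢ n
fix-size≢n-1 {n} σ σ-inj |fix|+1≡n = excluded (fix-size-gap σ σ-inj)
  where
  n≡1+|fix| : n ≡ 1 + ∣ Fix σ ∣
  n≡1+|fix| = trans (sym |fix|+1≡n) (ℕP.+-comm ∣ Fix σ ∣ 1)

  excluded : n ≤ ∣ Fix σ ∣ ⊎ 2 + ∣ Fix σ ∣ ≤ n → ⊥
  excluded (inj₁ n≤|fix|)   = ℕP.n≮n ∣ Fix σ ∣ (subst (_≤ ∣ Fix σ ∣) n≡1+|fix| n≤|fix|)
  excluded (inj₂ 2+|fix|≤n) =
    ℕP.n≮n ∣ Fix σ ∣ (ℕP.≤-pred (subst (2 + ∣ Fix σ ∣ ≤_) n≡1+|fix| 2+|fix|≤n))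

CommonFix : Raw n → Raw n → Fin n → Set
CommonFix σ τ x = Fixes σ x × Fixes τ x

commonFix? : (σ τ : Raw n) → Decidable (CommonFix σ τ)
commonFix? σ τ x = fixes? σ x ×-dec fixes? τ x

#commonFix : Raw n → Raw n → ℕ
#commonFix {n} σ τ = length (filter (commonFix? σ τ) (allFin n))

#commonFix-mono : ∀ {n} (ρ τ σ β : Raw n) → (∀ {x} → CommonFix ρ τ x → CommonFix σ β x) →
  #commonFix ρ τ ≤ #commonFix σ β
#commonFix-mono {n} ρ τ σ β common⇒common =
  count-mono (commonFix? ρ τ) (commonFix? σ β) common⇒common (⊑-refl {x = allFin n})

-- The ij-fixing of ρ with j = ρ i: it fixes i, sends ρ⁻¹(i) to ρ i and agrees
-- with ρ elsewhere.
fixAt : Raw n → Fin n → Raw n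
fixAt ρ i = ijFix i (app ρ i) ρ

fixAt-app : (ρ : Raw n) (i y : Fin n) → app (fixAt ρ i) y ≡
  (if does (y Fin.≟ i) then i else if does (app ρ y Fin.≟ i) then app ρ i else app ρ y)
fixAt-app ρ i y with app ρ i Fin.≟ app ρ i
... | yes _    = VecP.lookup∘tabulate _ y
... | no ρi≢ρi = ⊥-elim (ρi≢ρi refl)

fixAt-fixes : (ρ : Raw n) (i : Fin n) → Fixes (fixAt ρ i) i
fixAt-fixes ρ i rewrite fixAt-app ρ i i with i Fin.≟ i
... | yes _  = refl
... | no i≢i = ⊥-elim (i≢i refl)

fixAt-keeps : (ρ : Raw n) (i : Fin n) {y : Fin n} → Fixes ρ y → Fixes (fixAt ρ i) y
fixAt-keeps ρ i {y} ρy≡y rewrite fixAt-app ρ i y with y Fin.≟ i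
... | yes y≡i = sym y≡i
... | no  y≢i with app ρ y Fin.≟ i
...   | yes ρy≡i = ⊥-elim (y≢i (trans (sym ρy≡y) ρy≡i))
...   | no  _    = ρy≡y

fixAt-grows : (ρ : Raw n) (i : Fin n) → ¬ Fixes ρ i → Fix ρ ⊂ Fix (fixAt ρ i)
fixAt-grows ρ i ρi≢i =
  (λ {y} y∈fix → ∈Fix⁺ (fixAt ρ i) (fixAt-keeps ρ i (∈Fix⁻ ρ y∈fix))) ,
  i , ∈Fix⁺ (fixAt ρ i) (fixAt-fixes ρ i) , ρi≢i ∘ ∈Fix⁻ ρ

fixAt-differs : (ρ τ : Raw n) (i : Fin n) → ¬ Fixes τ i → fixAt ρ i ≢ τ
fixAt-differs ρ τ i τi≢i ρ'≡τ = τi≢i (subst (λ σ → Fixes σ i) ρ'≡τ (fixAt-fixes ρ i))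

fixAt-common : (ρ τ : Raw n) (i : Fin n) → IsPerm τ → app τ i ≡ app ρ i → ¬ Fixes ρ i →
  ∀ {y} → CommonFix (fixAt ρ i) τ y → Fixes ρ y
fixAt-common ρ τ i τ-inj τi≡ρi ρi≢i {y} (ρ'y≡y , τy≡y) rewrite fixAt-app ρ i y with y Fin.≟ i
... | yes refl = ⊥-elim (ρi≢i (trans (sym τi≡ρi) τy≡y))
... | no  y≢i  with app ρ y Fin.≟ i
...   | yes _ = ⊥-elim (y≢i (τ-inj y i (trans τy≡y (trans (sym ρ'y≡y) (sym τi≡ρi)))))
...   | no  _ = ρ'y≡y

orbit-fixed : (σ : Raw n) → Fixes σ x → orbit σ x ≡ x ∷ []
orbit-fixed {suc n} {x} σ σx≡x with app σ x Fin.≟ x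
... | yes _     = refl
... | no  σx≢x  = ⊥-elim (σx≢x σx≡x)

successorIn : Fin n → List (Fin n) → Fin n
successorIn x (_ ∷ y ∷ _) = y
successorIn x _           = x

orbit-successor : (σ : Raw n) (x : Fin n) → app σ x ≡ successorIn x (orbit σ x)
orbit-successor {suc n} σ x with app σ x Fin.≟ x
... | yes σx≡x = σx≡x
... | no _     = refl

orbit-image : (σ τ : Raw n) → orbit σ x ≡ orbit τ x → app σ x ≡ app τ x
orbit-image {x = x} σ τ same = begin
  app σ x                      ≡⟨ orbit-successor σ x ⟩
  successorIn x (orbit σ x)    ≡⟨ cong (successorIn x) same ⟩
  successorIn x (orbit τ x)    ≡⟨ orbit-successor τ x ⟨
  app τ x                      ∎
  where open ≡-Reasoning

SharedLongCycle : Raw n → Raw n → Fin n → Set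
SharedLongCycle σ τ i = orbit σ i ≡ orbit τ i × ¬ Fixes σ i

sharedLongCycle? : (σ τ : Raw n) → Dec (∃ (SharedLongCycle σ τ))
sharedLongCycle? σ τ =
  FinP.any? λ i → ListP.≡-dec Fin._≟_ (orbit σ i) (orbit τ i) ×-dec ¬? (fixes? σ i)

module _ {n : ℕ} where
  open DecMem (ListP.≡-dec (Fin._≟_ {n})) using (_∈?_)

  -- x is the least point of its σ-cycle, so that cycle is listed in cycles σ.
  leader? : (σ : Raw n) → Decidable (λ x → All (x Fin.≤_) (orbit σ x))
  leader? σ x = all? (x Fin.≤?_) (orbit σ x)

  cycleShared? : (σ τ : Raw n) → Decidable (λ x → orbit σ x ∈ₗ cycles τ)
  cycleShared? σ τ x = orbit σ x ∈? cycles τ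

  commonCycles-count : (σ τ : Raw n) →
    commonCycles σ τ ≡ length (filter (cycleShared? σ τ) (filter (leader? σ) (allFin n)))
  commonCycles-count σ τ =
    trans (cong length (filter-map (_∈? cycles τ) (orbit σ) (filter (leader? σ) (allFin n))))
          (ListP.length-map (orbit σ) (filter (cycleShared? σ τ) (filter (leader? σ) (allFin n))))

  fixed⇒leader : (σ : Raw n) {x : Fin n} → Fixes σ x → All (x Fin.≤_) (orbit σ x)
  fixed⇒leader σ {x} σx≡x = subst (All (x Fin.≤_)) (sym (orbit-fixed σ σx≡x)) (FinP.≤-refl ∷ [])

  fixed⇒cycle : (σ : Raw n) {x : Fin n} → Fixes σ x → orbit σ x ∈ₗ cycles σ
  fixed⇒cycle σ {x} σx≡x =
    MemP.∈-map⁺ (orbit σ) (MemP.∈-filter⁺ (leader? σ) (MemP.∈-allFin x) (fixed⇒leader σ σx≡x))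

  -- Every common fixed point is a common 1-cycle.
  commonFix≤commonCycles : (σ τ : Raw n) → #commonFix σ τ ≤ commonCycles σ τ
  commonFix≤commonCycles σ τ = begin
    #commonFix σ τ
      ≡⟨ cong length (ListP.filter-idem (commonFix? σ τ) (allFin n)) ⟨
    length (filter (commonFix? σ τ) (filter (commonFix? σ τ) (allFin n)))
      ≤⟨ count-mono (commonFix? σ τ) (cycleShared? σ τ) common⇒shared common⊑leaders ⟩
    length (filter (cycleShared? σ τ) (filter (leader? σ) (allFin n)))
      ≡⟨ commonCycles-count σ τ ⟨
    commonCycles σ τ ∎
    where
    open ℕP.≤-Reasoning
    common⇒shared : ∀ {x} → CommonFix σ τ x → orbit σ x ∈ₗ cycles τ
    common⇒shared (σx≡x , τx≡x) = subst (_∈ₗ cycles τ)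
      (trans (orbit-fixed τ τx≡x) (sym (orbit-fixed σ σx≡x))) (fixed⇒cycle τ τx≡x)

    common⊑leaders : filter (commonFix? σ τ) (allFin n) ⊑ filter (leader? σ) (allFin n)
    common⊑leaders = Sublist.filter⁺ (commonFix? σ τ) (leader? σ)
      (λ { refl (σx≡x , _) → fixed⇒leader σ σx≡x }) (⊑-refl {x = allFin n})

  commonCycles≤commonFix : (σ τ : Raw n) → ¬ ∃ (SharedLongCycle σ τ) →
    commonCycles σ τ ≤ #commonFix σ τ
  commonCycles≤commonFix σ τ none = begin
    commonCycles σ τ
      ≡⟨ commonCycles-count σ τ ⟩
    length (filter (cycleShared? σ τ) (filter (leader? σ) (allFin n)))
      ≤⟨ count-mono (cycleShared? σ τ) (commonFix? σ τ) shared⇒common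
           (Sublist.filter-⊆ (leader? σ) (allFin n)) ⟩
    #commonFix σ τ ∎
    where
    open ℕP.≤-Reasoning
    shared⇒common : ∀ {x} → orbit σ x ∈ₗ cycles τ → CommonFix σ τ x
    shared⇒common {x} shared with MemP.∈-map⁻ (orbit τ) shared
    ... | y , _ , same with ListP.∷-injectiveˡ same
    ... | refl = σx≡x , trans (sym (orbit-image σ τ same)) σx≡x
      where
      σx≡x : Fixes σ x
      σx≡x = decidable-stable (fixes? σ x) (λ σx≢x → none (x , same , σx≢x))

UpwardClosed : Family n → Set
UpwardClosed A = ∀ σ τ → IsPerm σ → τ ∈F A → Fix τ ⊆ₛ Fix σ → σ ∈F A

inserted⁻ : ∀ (A : Family n) σ α → α ∈F insertF σ A → α ∈F A ⊎ α ≡ σ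
inserted⁻ A σ α α∈A∪σ with A α | α ≟R σ
... | true  | _       = inj₁ refl
... | false | yes α≡σ = inj₂ α≡σ
... | false | no  _   with () ← α∈A∪σ

module FixedIntersecting {n t : ℕ} (A : Family n) (A⊆Sn : SubsetOfSn A)
                         (A-int : CycleIntersecting t A) (A-fixed : Fixed A) where

  fixing-closed : ∀ {ρ} → ρ ∈F A → ∀ {i j} → i ≢ j → ijFix i j ρ ∈F A
  fixing-closed {ρ} ρ∈A {i} {j} i≢j
    with A (ijFix i j ρ) in ρ'-status | proj₁ (A-fixed i j i≢j (triangle A i j ρ)) (ρ , ρ∈A , refl)
  ... | true  | _        = refl
  ... | false | ρ'∈A     = trans (sym ρ'-status) ρ'∈A   -- here ◁ij(ρ) is the fixing itself

  -- While ρ and τ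
  -- share a cycle of length ≥ 2 through i, replace ρ by fixAt ρ i: it lies in A,
  -- differs from τ, has no new common fixed point with τ, and moves fewer points
  -- than ρ, which bounds the number of replacements.
  common-fixed-points : ∀ {ρ τ} → ρ ∈F A → τ ∈F A → ρ ≢ τ → t ≤ #commonFix ρ τ
  common-fixed-points {ρ} = go (suc ∣ ∁ (Fix ρ) ∣) ℕP.≤-refl
    where
    go : ∀ bound {ρ τ} → ∣ ∁ (Fix ρ) ∣ < bound → ρ ∈F A → τ ∈F A → ρ ≢ τ → t ≤ #commonFix ρ τ
    go zero        ()
    go (suc bound) {ρ} {τ} moved<bound ρ∈A τ∈A ρ≢τ with sharedLongCycle? ρ τ
    ... | no none = ℕP.≤-trans (A-int ρ τ ρ∈A τ∈A ρ≢τ) (commonCycles≤commonFix ρ τ none)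
    ... | yes (i , same , ρi≢i) =
      ℕP.≤-trans (go bound fewer-moved (fixing-closed ρ∈A (ρi≢i ∘ sym)) τ∈A ρ'≢τ)
                 (#commonFix-mono ρ' τ ρ τ no-new-common)
      where
      ρ' = fixAt ρ i

      τi≡ρi : app τ i ≡ app ρ i
      τi≡ρi = sym (orbit-image ρ τ same)

      ρ'≢τ : ρ' ≢ τ
      ρ'≢τ = fixAt-differs ρ τ i (λ τi≡i → ρi≢i (trans (sym τi≡ρi) τi≡i))

      no-new-common : ∀ {y} → CommonFix ρ' τ y → CommonFix ρ τ y
      no-new-common common = fixAt-common ρ τ i (A⊆Sn τ τ∈A) τi≡ρi ρi≢i common , proj₂ common

      fewer-moved : ∣ ∁ (Fix ρ') ∣ < bound
      fewer-moved = ℕP.<-≤-trans (SP.p⊂q⇒∣p∣<∣q∣ (SP.p⊂q⇒∁p⊃∁q (fixAt-grows ρ i ρi≢i)))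
                                 (ℕP.≤-pred moved<bound)

  -- A maximal such family is upward closed: if fix(τ) ⊆ fix(σ) with τ ∈ A, then σ
  -- shares at least t fixed points with every other member of A, so A ∪ {σ} is
  -- still t-cycle-intersecting and maximality forces σ ∈ A.
  upward-closed : (∀ σ → IsPerm σ → ¬ (σ ∈F A) → ¬ CycleIntersecting t (insertF σ A)) →
    UpwardClosed A
  upward-closed A-max σ τ σ-perm τ∈A fixτ⊆fixσ with A σ Bool.≟ true
  ... | yes σ∈A = σ∈A
  ... | no  σ∉A = ⊥-elim (A-max σ σ-perm σ∉A A∪σ-int)
    where
    τ⇒σ : ∀ {x} → Fixes τ x → Fixes σ x
    τ⇒σ τx≡x = ∈Fix⁻ σ (fixτ⊆fixσ (∈Fix⁺ τ τx≡x))

    -- σ shares at least t fixed points with each other member β of A: through τ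
    -- when β ≠ τ, and through a fixing of τ (which is not the identity) when β = τ.
    σ-meets-A : ∀ β → β ∈F A → β ≢ σ → t ≤ #commonFix σ β
    σ-meets-A β β∈A β≢σ with β ≟R τ
    ... | no β≢τ = ℕP.≤-trans (common-fixed-points τ∈A β∈A (β≢τ ∘ sym))
                              (#commonFix-mono τ β σ β λ (τx , βx) → τ⇒σ τx , βx)
    ... | yes refl with distinct⇒moves τ⇒σ β≢σ
    ...   | i , τi≢i =
      ℕP.≤-trans (common-fixed-points (fixing-closed τ∈A (τi≢i ∘ sym)) τ∈A
                                      (fixAt-differs τ τ i τi≢i))
                 (#commonFix-mono (fixAt τ i) τ σ τ λ (_ , τx) → τ⇒σ τx , τx)

    A∪σ-int : CycleIntersecting t (insertF σ A)
    A∪σ-int α β α∈ β∈ α≢β with inserted⁻ A σ α α∈ | inserted⁻ A σ β β∈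
    ... | inj₁ α∈A  | inj₁ β∈A  = A-int α β α∈A β∈A α≢β
    ... | inj₂ refl | inj₂ refl = ⊥-elim (α≢β refl)
    ... | inj₂ refl | inj₁ β∈A  =
      ℕP.≤-trans (σ-meets-A β β∈A (α≢β ∘ sym)) (commonFix≤commonCycles σ β)
    ... | inj₁ α∈A  | inj₂ refl =
      ℕP.≤-trans (σ-meets-A α α∈A α≢β)
        (ℕP.≤-trans (#commonFix-mono σ α α σ λ (σx , αx) → αx , σx) (commonFix≤commonCycles α σ))

module Generators {n : ℕ} (A : Family n) where

  Generator : Subset n → Set
  Generator B = (∃ λ τ → τ ∈F A × Fix τ ⊆ₛ B) × ∣ B ∣ + 1 ≢ n

  generator? : Decidable Generator
  generator? B =
    anyVec? n (λ τ → (A τ Bool.≟ true) ×-dec (Fix τ SP.⊆? B)) ×-dec ¬? (∣ B ∣ + 1 ℕ.≟ n)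

  generators : SetFamily n
  generators B = does (generator? B)

  -- An upward closed A ⊆ S_n is generated by its generators: σ ∈ A is covered by
  -- the generator fix(σ), and a permutation fixing a generator B ⊇ fix(τ) lies in A
  -- by upward closure.
  generators-generate : UpwardClosed A → IsGeneratingSet A generators
  generators-generate A-up = generator-size , covers
    where
    generator-size : ∀ B → generators B ≡ true → ∣ B ∣ + 1 ≢ n
    generator-size B B-gen = proj₂ (does-true⁻ (generator? B) B-gen)

    covers : ∀ σ → IsPerm σ → (σ ∈F A → InUp generators σ) × (InUp generators σ → σ ∈F A)
    covers σ σ-perm = from-A , to-A
      where
      from-A : σ ∈F A → InUp generators σ
      from-A σ∈A = Fix σ , dec-true (generator? (Fix σ)) fixσ-generates , λ x → ∈Fix⁻ σ
        where
        fixσ-generates : Generator (Fix σ)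
        fixσ-generates = (σ , σ∈A , SP.⊆-refl) , fix-size≢n-1 σ σ-perm

      to-A : InUp generators σ → σ ∈F A
      to-A (B , B-gen , B⊆fixσ) with does-true⁻ (generator? B) B-gen
      ... | (τ , τ∈A , fixτ⊆B) , _ =
        A-up σ τ σ-perm τ∈A (λ {x} x∈fixτ → ∈Fix⁺ σ (B⊆fixσ x (fixτ⊆B x∈fixτ)))

corollary2p9 : (n t : ℕ) → 1 ≤ t → (A : Family n) →
    Maximal n t A → Fixed A → Σ (SetFamily n) (λ g → IsGeneratingSet A g)
corollary2p9 n t _ A ((A⊆Sn , A-int) , A-max) A-fixed =
  generators , generators-generate (upward-closed A-max)
  where
  open FixedIntersecting A A⊆Sn A-int A-fixed using (upward-closed)
  open Generators A using (generators; generators-generate)
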